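{- Let $r\ge1$ and let $(G,R)$ be a $2$-coloring of $AG(r-1,2)$ with $|G|=|R|$. Then $r(G)=r(R)$.
   Context: $AG(r-1,2)$ denotes the rank-$r$ binary affine geometry. A $2$-coloring $(G,R)$ of $AG(r-1,2)$ is a partition of its ground set into possibly empty sets $G$ and $R$. Ranks are computed in $AG(r-1,2)$. -}

module Defs where

open import Data.Bool using (Bool; true; false; _xor_; _∧_; not; if_then_else_)
open import Data.Nat using (ℕ; zero; suc; _⊔_)
open import Data.List using (List; []; _∷_; _++_; map; filter; length; concatMap; foldr; all)
open import Data.Vec using (Vec; []; _∷_; zipWith; replicate)
open import Relation.Nullary.Decidable using (Dec; yes; no)
open import Relation.Binary.PropositionalEquality using (_≡_)
open import Data.Bool.Properties using () renaming (_≟_ to _≟ᵇ_)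
open import Data.Bool.ListAction using (or)

-- Vectors of GF(2)^n, with GF(2) = Bool (false = 0, true = 1, addition = xor).
V : ℕ → Set
V n = Vec Bool n

_⊕_ : ∀ {n} → V n → V n → V n
_⊕_ = zipWith _xor_

0ᵥ : ∀ {n} → V n
0ᵥ = replicate _ false

isZero : ∀ {n} → V n → Bool
isZero [] = true
isZero (b ∷ v) = not b ∧ isZero v

-- AG(r-1,2) with r = suc m: the ground set is the set of vectors of GF(2)^r
-- whose first coordinate is 1 (the complement of a hyperplane of PG(r-1,2)).
-- An element is represented by its last m coordinates p : V m; the actual
-- vector in GF(2)^r is  embed p = 1 ∷ p.
Point : ℕ → Set
Point m = V m

embed : ∀ {m} → Point m → V (suc m)
embed p = true ∷ p

allPoints : (m : ℕ) → List (Point m)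
allPoints zero = [] ∷ []
allPoints (suc m) = map (false ∷_) (allPoints m) ++ map (true ∷_) (allPoints m)

Subset : ℕ → Set
Subset m = Point m → Bool

elems : ∀ {m} → Subset m → List (Point m)
elems {m} X = filter (λ p → X p ≟ᵇ true) (allPoints m)

∣_∣ : ∀ {m} → Subset m → ℕ
∣ X ∣ = length (elems X)

sublists : ∀ {A : Set} → List A → List (List A)
sublists [] = [] ∷ []
sublists (x ∷ xs) = let s = sublists xs in map (x ∷_) s ++ s

nonemptySublists : ∀ {A : Set} → List A → List (List A)
nonemptySublists [] = []
nonemptySublists (x ∷ xs) = map (x ∷_) (sublists xs) ++ nonemptySublists xs

sumV : ∀ {n} → List (V n) → V n
sumV = foldr _⊕_ 0ᵥ

-- a list of (distinct) vectors over GF(2) is linearly independent iff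
-- no nonempty subfamily sums to 0
independent : ∀ {n} → List (V n) → Bool
independent vs = not (or (map (λ s → isZero (sumV s)) (nonemptySublists vs)))

maximum : List ℕ → ℕ
maximum = foldr _⊔_ 0

-- matroid rank in AG(r-1,2) (i.e. in the binary matroid on the embedded
-- vectors of GF(2)^r): the maximum size of a linearly independent subset of X
rank : ∀ {m} → Subset m → ℕ
rank X = maximum (map length
           (filter (λ S → independent (map embed S) ≟ᵇ true) (sublists (elems X))))

compl : ∀ {m} → Subset m → Subset m
compl X p = not (X p)

-- Write r = m + 2, so that |G| = |R| = 2^m. A family of k independent vectors spans exactly
-- 2^(k-1) affine points (its odd subsums), so both colour classes have rank m + 1 or m + 2,
-- and it suffices to show that if R has rank m + 1 then so has G. In that case a basis of R
-- spans a hyperplane W whose 2^m affine points are exactly R, so G avoids W. Fix t ∈ G; every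
-- u ∈ G lies in t + W, hence for an independent T ⊆ G, adding t to the odd subsums of T maps
-- the 2^(|T|-1) of them injectively into the 2^m vectors of W with first coordinate 0.
module Submission where

open import Defs
open import Algebra.Bundles using (AbelianGroup)
import Algebra.Properties.AbelianGroup as AbelianGroupProperties
import Algebra.Properties.CommutativeSemigroup as CommutativeSemigroupProperties
open import Data.Bool using (Bool; true; false; _xor_; not; if_then_else_; T)
open import Data.Bool.ListAction using (any)
open import Data.Bool.Properties
  using (T-≡; xor-assoc; xor-comm; xor-identityˡ; xor-identityʳ; xor-same; not-injective; not-involutive)
  renaming (_≟_ to _≟ᵇ_)
open import Data.Empty using (⊥-elim)
open import Data.List using (List; []; _∷_; _++_; map; filter; length)
open import Data.List.Membership.Propositional using (_∈_; lose; find)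
open import Data.List.Membership.Propositional.Properties
  using (∈-map⁺; ∈-map⁻; ∈-++⁺ˡ; ∈-++⁺ʳ; ∈-++⁻; ∈-filter⁺; ∈-filter⁻)
open import Data.List.Properties
  using (length-map; length-++; filter-++; filter-notAll; foldr-preservesᵇ; foldr-preservesᵒ)
open import Data.List.Relation.Binary.Subset.Propositional using (_⊆_)
open import Data.List.Relation.Unary.All as All using ()
open import Data.List.Relation.Unary.All.Properties using (¬Any⇒All¬)
open import Data.List.Relation.Unary.Any as Any using (Any; here; there; any?)
open import Data.List.Relation.Unary.Any.Properties using (any⁺; any⁻)
open import Data.List.Relation.Unary.Unique.Propositional using (Unique; []; _∷_)
import Data.List.Relation.Unary.Unique.Propositional.Properties as Unique
open import Data.Nat using (ℕ; zero; suc; _+_; _^_; _≤_; z≤n; s≤s; ⌊_/2⌋)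
open import Data.Nat.Properties
  using (module ≤-Reasoning; ≤-trans; ≤-antisym; ≤-reflexive; _≤?_; <⇒≱; ≰⇒>; m^n>0; ^-monoʳ-<;
         ⊔-lub; m≤n⇒m≤n⊔o; m≤n⇒m≤o⊔n; +-identityʳ; +-suc; n≡⌊n+n/2⌋; even≢odd)
open import Data.Product using (∃; _×_; _,_; proj₂)
open import Data.Sum using (inj₁; inj₂; [_,_])
open import Data.Vec using ([]; _∷_; head)
open import Data.Vec.Properties
  using (zipWith-assoc; zipWith-comm; zipWith-identityˡ; zipWith-identityʳ; ∷-injectiveʳ; ≡-dec)
open import Function using (id; _∘_; _⇔_; mk⇔; Equivalence)
open import Level using (0ℓ)
open import Relation.Binary.Definitions using (DecidableEquality)
open import Relation.Binary.PropositionalEquality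
  using (_≡_; _≢_; refl; sym; trans; cong; cong₂; subst; subst₂; module ≡-Reasoning)
open import Relation.Binary.PropositionalEquality.Algebra using (isMagma)
open import Relation.Nullary using (¬_; Dec; yes; no; ¬?)
open import Relation.Nullary.Decidable using (map′)

module _ {A : Set} (_≟_ : DecidableEquality A) where

  Unique-⊆⇒length≤ : ∀ {xs ys : List A} → Unique xs → xs ⊆ ys → length xs ≤ length ys
  Unique-⊆⇒length≤ []                           _       = z≤n
  Unique-⊆⇒length≤ {x ∷ xs} {ys} (x∉xs ∷ xs!) x∷xs⊆ys =
    ≤-trans (s≤s (Unique-⊆⇒length≤ xs! xs⊆ys-x))
            (filter-notAll (¬? ∘ (x ≟_)) ys (Any.map (λ x≡y x≢y → x≢y x≡y) (x∷xs⊆ys (here refl))))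
    where
    xs⊆ys-x : xs ⊆ filter (¬? ∘ (x ≟_)) ys
    xs⊆ys-x z∈xs = ∈-filter⁺ (¬? ∘ (x ≟_)) (x∷xs⊆ys (there z∈xs)) (All.lookup x∉xs z∈xs)

  Unique-⊆-length≥⇒⊇ : ∀ {xs ys : List A} → Unique xs → xs ⊆ ys → length ys ≤ length xs → ys ⊆ xs
  Unique-⊆-length≥⇒⊇ {xs} {ys} xs! xs⊆ys ys≤xs {y} y∈ys with any? (y ≟_) xs
  ... | yes y∈xs = y∈xs
  ... | no  y∉xs = ⊥-elim (<⇒≱ (Unique-⊆⇒length≤ (¬Any⇒All¬ xs y∉xs ∷ xs!) y∷xs⊆ys) ys≤xs)
    where
    y∷xs⊆ys : y ∷ xs ⊆ ys
    y∷xs⊆ys (here refl)  = y∈ys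
    y∷xs⊆ys (there z∈xs) = xs⊆ys z∈xs

count : ∀ {A : Set} → (A → Bool) → List A → ℕ
count g xs = length (filter (λ x → g x ≟ᵇ true) xs)

module _ {A : Set} where

  count-++ : ∀ (g : A → Bool) xs ys → count g (xs ++ ys) ≡ count g xs + count g ys
  count-++ g xs ys =
    trans (cong length (filter-++ (λ x → g x ≟ᵇ true) xs ys)) (length-++ (filter (λ x → g x ≟ᵇ true) xs))

  count-map : ∀ {B : Set} (g : B → Bool) (f : A → B) xs → count g (map f xs) ≡ count (g ∘ f) xs
  count-map g f []       = refl
  count-map g f (x ∷ xs) with g (f x)
  ... | true  = cong suc (count-map g f xs)
  ... | false = count-map g f xs

  count-complement : ∀ (g h : A → Bool) → (∀ x → h x ≡ not (g x)) →
                     ∀ xs → count g xs + count h xs ≡ length xs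
  count-complement g h h≡not-g []       = refl
  count-complement g h h≡not-g (x ∷ xs) with g x | h x | h≡not-g x
  ... | true  | false | refl = cong suc (count-complement g h h≡not-g xs)
  ... | false | true  | refl =
    trans (+-suc (count g xs) (count h xs)) (cong suc (count-complement g h h≡not-g xs))

≤-maximum : ∀ {x xs} → x ∈ xs → x ≤ maximum xs
≤-maximum {xs = xs} x∈xs =
  foldr-preservesᵒ (λ a b → [ m≤n⇒m≤n⊔o b , m≤n⇒m≤o⊔n a ]) 0 xs (inj₂ (Any.map ≤-reflexive x∈xs))

maximum≤ : ∀ {b xs} → (∀ {x} → x ∈ xs → x ≤ b) → maximum xs ≤ b
maximum≤ xs≤b = foldr-preservesᵇ ⊔-lub z≤n (All.tabulate xs≤b)

2^-cancel-≤ : ∀ {a b} → 2 ^ a ≤ 2 ^ b → a ≤ b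
2^-cancel-≤ {a} {b} 2^a≤2^b with a ≤? b
... | yes a≤b = a≤b
... | no  a≰b = ⊥-elim (<⇒≱ (^-monoʳ-< 2 (s≤s (s≤s z≤n)) (≰⇒> a≰b)) 2^a≤2^b)

∈-allPoints : ∀ {k} (v : V k) → v ∈ allPoints k
∈-allPoints []                  = here refl
∈-allPoints {suc k} (false ∷ v) = ∈-++⁺ˡ (∈-map⁺ (false ∷_) (∈-allPoints v))
∈-allPoints {suc k} (true  ∷ v) = ∈-++⁺ʳ (map (false ∷_) (allPoints k)) (∈-map⁺ (true ∷_) (∈-allPoints v))

allPoints-unique : ∀ k → Unique (allPoints k)
allPoints-unique zero    = All.[] ∷ []
allPoints-unique (suc k) =
  Unique.++⁺ (Unique.map⁺ ∷-injectiveʳ (allPoints-unique k))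
             (Unique.map⁺ ∷-injectiveʳ (allPoints-unique k)) disjoint
  where
  disjoint : ∀ {v} → ¬ (v ∈ map (false ∷_) (allPoints k) × v ∈ map (true ∷_) (allPoints k))
  disjoint (v∈₀ , v∈₁) with ∈-map⁻ (false ∷_) v∈₀ | ∈-map⁻ (true ∷_) v∈₁
  ... | _ , _ , refl | _ , _ , ()

length-allPoints : ∀ k → length (allPoints k) ≡ 2 ^ k
length-allPoints zero    = refl
length-allPoints (suc k) = begin
  length (map (false ∷_) (allPoints k) ++ map (true ∷_) (allPoints k))
    ≡⟨ length-++ (map (false ∷_) (allPoints k)) ⟩
  length (map (false ∷_) (allPoints k)) + length (map (true ∷_) (allPoints k))
    ≡⟨ cong₂ _+_ (length-map _ (allPoints k)) (length-map _ (allPoints k)) ⟩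
  length (allPoints k) + length (allPoints k)
    ≡⟨ cong₂ _+_ (length-allPoints k) (trans (length-allPoints k) (sym (+-identityʳ (2 ^ k)))) ⟩
  2 ^ k + (2 ^ k + 0) ∎
  where open ≡-Reasoning

∈-elems⁺ : ∀ {m} {X : Subset m} {p} → X p ≡ true → p ∈ elems X
∈-elems⁺ {X = X} Xp = ∈-filter⁺ (λ p → X p ≟ᵇ true) (∈-allPoints _) Xp

∈-elems⁻ : ∀ {m} {X : Subset m} {p} → p ∈ elems X → X p ≡ true
∈-elems⁻ {m} {X} p∈X = proj₂ (∈-filter⁻ (λ p → X p ≟ᵇ true) {xs = allPoints m} p∈X)

elems-unique : ∀ {m} (X : Subset m) → Unique (elems X)
elems-unique {m} X = Unique.filter⁺ (λ p → X p ≟ᵇ true) (allPoints-unique m)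

∣X∣+∣complX∣≡2^m : ∀ {m} (X : Subset m) → ∣ X ∣ + ∣ compl X ∣ ≡ 2 ^ m
∣X∣+∣complX∣≡2^m {m} X =
  trans (count-complement X (compl X) (λ _ → refl) (allPoints m)) (length-allPoints m)

balanced⇒∣∣≡2^k : ∀ {k} (X : Subset (suc k)) → (∀ p → X (true ∷ p) ≡ not (X (false ∷ p))) → ∣ X ∣ ≡ 2 ^ k
balanced⇒∣∣≡2^k {k} X balanced = begin
  count X (map (false ∷_) (allPoints k) ++ map (true ∷_) (allPoints k))
    ≡⟨ count-++ X (map (false ∷_) (allPoints k)) _ ⟩
  count X (map (false ∷_) (allPoints k)) + count X (map (true ∷_) (allPoints k))
    ≡⟨ cong₂ _+_ (count-map X (false ∷_) (allPoints k)) (count-map X (true ∷_) (allPoints k)) ⟩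
  count (X ∘ (false ∷_)) (allPoints k) + count (X ∘ (true ∷_)) (allPoints k)
    ≡⟨ count-complement (X ∘ (false ∷_)) (X ∘ (true ∷_)) balanced (allPoints k) ⟩
  length (allPoints k)
    ≡⟨ length-allPoints k ⟩
  2 ^ k ∎
  where open ≡-Reasoning

parity : ∀ {k} → V k → Bool
parity []      = false
parity (c ∷ a) = c xor parity a

∣parity∣≡2^ : ∀ {n k} → n ≡ suc k → ∣ parity {n} ∣ ≡ 2 ^ k
∣parity∣≡2^ {k = k} refl = balanced⇒∣∣≡2^k {k} parity (λ _ → refl)

∣compl-parity∣≡2^ : ∀ {n k} → n ≡ suc k → ∣ compl (parity {n}) ∣ ≡ 2 ^ k
∣compl-parity∣≡2^ {k = k} refl = balanced⇒∣∣≡2^k {k} (compl parity) (λ _ → refl)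

⊕-self : ∀ {n} (u : V n) → u ⊕ u ≡ 0ᵥ
⊕-self []      = refl
⊕-self (b ∷ u) = cong₂ _∷_ (xor-same b) (⊕-self u)

⊕-abelianGroup : ℕ → AbelianGroup 0ℓ 0ℓ
⊕-abelianGroup n = record
  { Carrier        = V n
  ; _≈_            = _≡_
  ; _∙_            = _⊕_
  ; ε              = 0ᵥ
  ; _⁻¹            = id
  ; isAbelianGroup = record
    { isGroup = record
      { isMonoid = record
        { isSemigroup = record { isMagma = isMagma _⊕_ ; assoc = zipWith-assoc xor-assoc }
        ; identity    = zipWith-identityˡ xor-identityˡ , zipWith-identityʳ xor-identityʳ
        }
      ; inverse  = ⊕-self , ⊕-self
      ; ⁻¹-cong  = id
      }
    ; comm    = zipWith-comm xor-comm
    }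
  }

open module ⊕-Group {n} = AbelianGroup (⊕-abelianGroup n)
  using () renaming (identityˡ to ⊕-identityˡ; identityʳ to ⊕-identityʳ)
open module ⊕-GroupProperties {n} = AbelianGroupProperties (⊕-abelianGroup n)
  using (x∙y⁻¹≈ε⇒x≈y; xyx⁻¹≈y; ∙-cancelʳ)
open module ⊕-SemigroupProperties {n} =
  CommutativeSemigroupProperties (AbelianGroup.commutativeSemigroup (⊕-abelianGroup n))
  using (interchange)

_≟ᵥ_ : ∀ {n} → DecidableEquality (V n)
_≟ᵥ_ = ≡-dec _≟ᵇ_

head-⊕ : ∀ {n} (u v : V (suc n)) → head (u ⊕ v) ≡ head u xor head v
head-⊕ (a ∷ u) (b ∷ v) = refl

isZero⇒≡0ᵥ : ∀ {n} (u : V n) → isZero u ≡ true → u ≡ 0ᵥ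
isZero⇒≡0ᵥ []          _  = refl
isZero⇒≡0ᵥ (false ∷ u) eq = cong (false ∷_) (isZero⇒≡0ᵥ u eq)

isZero-0ᵥ : ∀ n → isZero (0ᵥ {n}) ≡ true
isZero-0ᵥ zero    = refl
isZero-0ᵥ (suc n) = isZero-0ᵥ n

scale : ∀ {n} → Bool → V n → V n
scale c v = if c then v else 0ᵥ

scale-xor : ∀ {n} c d (v : V n) → scale (c xor d) v ≡ scale c v ⊕ scale d v
scale-xor true  true  v = sym (⊕-self v)
scale-xor true  false v = sym (⊕-identityʳ v)
scale-xor false d     v = sym (⊕-identityˡ (scale d v))

scale-⊕ : ∀ {n} c (u v : V n) → scale c (u ⊕ v) ≡ scale c u ⊕ scale c v
scale-⊕ true  u v = refl
scale-⊕ false u v = sym (⊕-identityˡ 0ᵥ)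

combination : ∀ {m} (S : List (Point m)) → V (length S) → V (suc m)
combination []      []      = 0ᵥ
combination (x ∷ S) (c ∷ a) = scale c (embed x) ⊕ combination S a

combination-0ᵥ : ∀ {m} (S : List (Point m)) → combination S 0ᵥ ≡ 0ᵥ
combination-0ᵥ []      = refl
combination-0ᵥ (x ∷ S) = trans (⊕-identityˡ _) (combination-0ᵥ S)

combination-⊕ : ∀ {m} (S : List (Point m)) a b →
                combination S (a ⊕ b) ≡ combination S a ⊕ combination S b
combination-⊕ []      []      []      = sym (⊕-identityˡ 0ᵥ)
combination-⊕ (x ∷ S) (c ∷ a) (d ∷ b) = begin
  scale (c xor d) (embed x) ⊕ combination S (a ⊕ b)
    ≡⟨ cong₂ _⊕_ (scale-xor c d (embed x)) (combination-⊕ S a b) ⟩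
  (scale c (embed x) ⊕ scale d (embed x)) ⊕ (combination S a ⊕ combination S b)
    ≡⟨ interchange _ _ _ _ ⟩
  (scale c (embed x) ⊕ combination S a) ⊕ (scale d (embed x) ⊕ combination S b) ∎
  where open ≡-Reasoning

head-combination : ∀ {m} (S : List (Point m)) a → head (combination S a) ≡ parity a
head-combination []      []          = refl
head-combination (x ∷ S) (true  ∷ a) =
  trans (head-⊕ (embed x) (combination S a)) (cong not (head-combination S a))
head-combination (x ∷ S) (false ∷ a) =
  trans (head-⊕ (scale false (embed x)) (combination S a)) (head-combination S a)

span : ∀ {m} (S : List (Point m)) → List (V (suc m))
span S = map (combination S) (allPoints (length S))

length-span : ∀ {m} (S : List (Point m)) → length (span S) ≡ 2 ^ length S
length-span S = trans (length-map (combination S) (allPoints (length S))) (length-allPoints (length S))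

-- A record rather than a Σ-type, so that S can be inferred from InSpan S v.
record InSpan {m} (S : List (Point m)) (v : V (suc m)) : Set where
  constructor _,_
  field
    coefficients  : V (length S)
    combination≡v : combination S coefficients ≡ v

InSpan-0ᵥ : ∀ {m} (S : List (Point m)) → InSpan S 0ᵥ
InSpan-0ᵥ S = 0ᵥ , combination-0ᵥ S

InSpan-⊕ : ∀ {m} {S : List (Point m)} {u v} → InSpan S u → InSpan S v → InSpan S (u ⊕ v)
InSpan-⊕ {S = S} (a , refl) (b , refl) = a ⊕ b , combination-⊕ S a b

InSpan-scale : ∀ {m} {S : List (Point m)} {v} c → InSpan S v → InSpan S (scale c v)
InSpan-scale         true  v∈S = v∈S
InSpan-scale {S = S} false _   = InSpan-0ᵥ S

InSpan-here : ∀ {m} (S : List (Point m)) x → InSpan (x ∷ S) (embed x)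
InSpan-here S x = true ∷ 0ᵥ , trans (cong (embed x ⊕_) (combination-0ᵥ S)) (⊕-identityʳ (embed x))

InSpan-there : ∀ {m} {S : List (Point m)} {v} x → InSpan S v → InSpan (x ∷ S) v
InSpan-there {S = S} x (a , eq) = false ∷ a , trans (⊕-identityˡ (combination S a)) eq

InSpan? : ∀ {m} (S : List (Point m)) v → Dec (InSpan S v)
InSpan? S v = map′ witness (λ (a , eq) → lose (∈-allPoints a) eq)
                   (any? (λ a → combination S a ≟ᵥ v) (allPoints (length S)))
  where
  witness : Any (λ a → combination S a ≡ v) (allPoints (length S)) → InSpan S v
  witness a∈ with find a∈
  ... | a , _ , eq = a , eq

Independent : ∀ {m} → List (Point m) → Set
Independent S = ∀ a → combination S a ≡ 0ᵥ → a ≡ 0ᵥ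

combination-injective : ∀ {m} {S : List (Point m)} → Independent S →
                        ∀ {a b} → combination S a ≡ combination S b → a ≡ b
combination-injective {S = S} S-indep {a} {b} eq = x∙y⁻¹≈ε⇒x≈y a b (S-indep (a ⊕ b) (begin
  combination S (a ⊕ b)             ≡⟨ combination-⊕ S a b ⟩
  combination S a ⊕ combination S b ≡⟨ cong (_⊕ combination S b) eq ⟩
  combination S b ⊕ combination S b ≡⟨ ⊕-self (combination S b) ⟩
  0ᵥ                                ∎))
  where open ≡-Reasoning

Independent-∷ : ∀ {m} {S : List (Point m)} {x} → Independent S → ¬ InSpan S (embed x) → Independent (x ∷ S)
Independent-∷ S-indep x∉S (false ∷ a) eq = cong (false ∷_) (S-indep a (trans (sym (⊕-identityˡ _)) eq))
Independent-∷ S-indep x∉S (true  ∷ a) eq = ⊥-elim (x∉S (a , sym (x∙y⁻¹≈ε⇒x≈y _ _ eq)))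

Independent⇒span-unique : ∀ {m} {S : List (Point m)} → Independent S → Unique (span S)
Independent⇒span-unique {S = S} S-indep =
  Unique.map⁺ (combination-injective {S = S} S-indep) (allPoints-unique (length S))

Independent⇒length≤1+m : ∀ {m} {S : List (Point m)} → Independent S → length S ≤ suc m
Independent⇒length≤1+m {m} {S} S-indep = 2^-cancel-≤
  (subst₂ _≤_ (length-span S) (length-allPoints (suc m))
    (Unique-⊆⇒length≤ _≟ᵥ_ (Independent⇒span-unique {S = S} S-indep) (λ _ → ∈-allPoints _)))

Independent⇒spanning : ∀ {m} {S : List (Point m)} → Independent S → length S ≡ suc m → ∀ v → InSpan S v
Independent⇒spanning {m} {S} S-indep ∣S∣≡ v =
  let a , _ , v≡ = ∈-map⁻ (combination S) (all⊆span (∈-allPoints v)) in a , sym v≡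
  where
  all⊆span : allPoints (suc m) ⊆ span S
  all⊆span = Unique-⊆-length≥⇒⊇ _≟ᵥ_ (Independent⇒span-unique {S = S} S-indep) (λ _ → ∈-allPoints _)
    (≤-reflexive (trans (length-allPoints (suc m)) (trans (cong (2 ^_) (sym ∣S∣≡)) (sym (length-span S)))))

select : ∀ {A : Set} (S : List A) → V (length S) → List A
select []      []          = []
select (x ∷ S) (true  ∷ a) = x ∷ select S a
select (x ∷ S) (false ∷ a) = select S a

sumV-select : ∀ {m} (S : List (Point m)) a → sumV (map embed (select S a)) ≡ combination S a
sumV-select []      []          = refl
sumV-select (x ∷ S) (true  ∷ a) = cong (embed x ⊕_) (sumV-select S a)
sumV-select (x ∷ S) (false ∷ a) = trans (sumV-select S a) (sym (⊕-identityˡ (combination S a)))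

∈sublists⇒⊆ : ∀ {A : Set} (E : List A) {s} → s ∈ sublists E → s ⊆ E
∈sublists⇒⊆ []      (here refl) ()
∈sublists⇒⊆ (e ∷ E) s∈ z∈s with ∈-++⁻ (map (e ∷_) (sublists E)) s∈
... | inj₂ s∈E = there (∈sublists⇒⊆ E s∈E z∈s)
... | inj₁ e∷s∈ with ∈-map⁻ (e ∷_) e∷s∈ | z∈s
...   | _ , _   , refl | here refl  = here refl
...   | _ , s∈E , refl | there z∈s′ = there (∈sublists⇒⊆ E s∈E z∈s′)

module _ {A B : Set} (f : A → B) where

  map-select∈sublists : ∀ (S : List A) a → map f (select S a) ∈ sublists (map f S)
  map-select∈sublists []      []          = here refl
  map-select∈sublists (x ∷ S) (true  ∷ a) = ∈-++⁺ˡ (∈-map⁺ (f x ∷_) (map-select∈sublists S a))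
  map-select∈sublists (x ∷ S) (false ∷ a) =
    ∈-++⁺ʳ (map (f x ∷_) (sublists (map f S))) (map-select∈sublists S a)

  map-select∈nonemptySublists : ∀ (S : List A) a → isZero a ≡ false →
                                map f (select S a) ∈ nonemptySublists (map f S)
  map-select∈nonemptySublists []      []          ()
  map-select∈nonemptySublists (x ∷ S) (true  ∷ a) _   = ∈-++⁺ˡ (∈-map⁺ (f x ∷_) (map-select∈sublists S a))
  map-select∈nonemptySublists (x ∷ S) (false ∷ a) a≢0 =
    ∈-++⁺ʳ (map (f x ∷_) (sublists (map f S))) (map-select∈nonemptySublists S a a≢0)

  ∈sublists⇒map-select : ∀ (S : List A) {s} → s ∈ sublists (map f S) → ∃ λ a → s ≡ map f (select S a)
  ∈sublists⇒map-select []      (here refl) = [] , refl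
  ∈sublists⇒map-select (x ∷ S) s∈ with ∈-++⁻ (map (f x ∷_) (sublists (map f S))) s∈
  ... | inj₂ s∈S = let a , s≡ = ∈sublists⇒map-select S s∈S in false ∷ a , s≡
  ... | inj₁ s∈x∷S with ∈-map⁻ (f x ∷_) s∈x∷S
  ...   | s′ , s′∈S , refl = let a , s′≡ = ∈sublists⇒map-select S s′∈S in true ∷ a , cong (f x ∷_) s′≡

  ∈nonemptySublists⇒map-select : ∀ (S : List A) {s} → s ∈ nonemptySublists (map f S) →
                                 ∃ λ a → isZero a ≡ false × s ≡ map f (select S a)
  ∈nonemptySublists⇒map-select (x ∷ S) s∈ with ∈-++⁻ (map (f x ∷_) (sublists (map f S))) s∈
  ... | inj₂ s∈S = let a , a≢0 , s≡ = ∈nonemptySublists⇒map-select S s∈S in false ∷ a , a≢0 , s≡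
  ... | inj₁ s∈x∷S with ∈-map⁻ (f x ∷_) s∈x∷S
  ...   | s′ , s′∈S , refl = let a , s′≡ = ∈sublists⇒map-select S s′∈S in true ∷ a , refl , cong (f x ∷_) s′≡

not≡true⇔¬T : ∀ b → not b ≡ true ⇔ (¬ T b)
not≡true⇔¬T false = mk⇔ (λ _ ()) (λ _ → refl)
not≡true⇔¬T true  = mk⇔ (λ ()) (λ ¬T → ⊥-elim (¬T _))

module _ {m} (S : List (Point m)) where

  private
    sumsToZero : List (V (suc m)) → Bool
    sumsToZero s = isZero (sumV s)

    sumsToZero⇔ : ∀ a → T (sumsToZero (map embed (select S a))) ⇔ (combination S a ≡ 0ᵥ)
    sumsToZero⇔ a = mk⇔
      (λ t → isZero⇒≡0ᵥ _ (trans (cong isZero (sym (sumV-select S a))) (Equivalence.to T-≡ t)))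
      (λ eq → Equivalence.from T-≡ (trans (cong isZero (trans (sumV-select S a) eq)) (isZero-0ᵥ (suc m))))

  independent⇒Independent : independent (map embed S) ≡ true → Independent S
  independent⇒Independent indep a comb≡0 with isZero a in isZero-a
  ... | true  = isZero⇒≡0ᵥ a isZero-a
  ... | false = ⊥-elim (Equivalence.to (not≡true⇔¬T _) indep
                  (any⁺ sumsToZero (lose (map-select∈nonemptySublists embed S a isZero-a)
                                         (Equivalence.from (sumsToZero⇔ a) comb≡0))))

  Independent⇒independent : Independent S → independent (map embed S) ≡ true
  Independent⇒independent S-indep = Equivalence.from (not≡true⇔¬T _) no-zero-sum
    where
    no-zero-sum : ¬ T (any sumsToZero (nonemptySublists (map embed S)))
    no-zero-sum t with find (any⁻ sumsToZero _ t)
    ... | s , s∈ , Ts with ∈nonemptySublists⇒map-select embed S s∈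
    ...   | a , isZero-a , refl with S-indep a (Equivalence.to (sumsToZero⇔ a) Ts)
    ...     | refl with trans (sym isZero-a) (isZero-0ᵥ (length S))
    ...       | ()

length≤rank : ∀ {m} (X : Subset m) {S} → S ∈ sublists (elems X) → Independent S → length S ≤ rank X
length≤rank X {S} S∈ S-indep = ≤-maximum (∈-map⁺ length
  (∈-filter⁺ (λ S → independent (map embed S) ≟ᵇ true) S∈ (Independent⇒independent S S-indep)))

rank≤ : ∀ {m} (X : Subset m) {b} → (∀ {S} → S ∈ sublists (elems X) → Independent S → length S ≤ b) → rank X ≤ b
rank≤ {m} X bound = maximum≤ λ n∈ →
  let S , S∈ , n≡ = ∈-map⁻ length n∈ ; S∈sublists , indep = ∈-filter⁻ independent? S∈
  in subst (_≤ _) (sym n≡) (bound S∈sublists (independent⇒Independent S indep))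
  where
  independent? = λ (S : List (Point m)) → independent (map embed S) ≟ᵇ true

rank≤1+m : ∀ {m} (X : Subset m) → rank X ≤ suc m
rank≤1+m X = rank≤ X (λ {S} _ S-indep → Independent⇒length≤1+m {S = S} S-indep)

record Basis {m} (E : List (Point m)) : Set where
  field
    vectors          : List (Point m)
    vectors∈sublists : vectors ∈ sublists E
    isIndependent    : Independent vectors
    spans            : ∀ {x} → x ∈ E → InSpan vectors (embed x)

greedyBasis : ∀ {m} (E : List (Point m)) → Basis E
greedyBasis [] = record
  { vectors = [] ; vectors∈sublists = here refl ; isIndependent = λ { [] _ → refl } ; spans = λ () }
greedyBasis (x ∷ E) with greedyBasis E
... | B with InSpan? (Basis.vectors B) (embed x)
...   | yes x∈span = record
  { vectors          = vectors
  ; vectors∈sublists = ∈-++⁺ʳ (map (x ∷_) (sublists E)) vectors∈sublists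
  ; isIndependent    = isIndependent
  ; spans            = λ { (here refl) → x∈span ; (there y∈E) → spans y∈E }
  }
  where open Basis B
...   | no x∉span = record
  { vectors          = x ∷ vectors
  ; vectors∈sublists = ∈-++⁺ˡ (∈-map⁺ (x ∷_) vectors∈sublists)
  ; isIndependent    = Independent-∷ {S = vectors} isIndependent x∉span
  ; spans            = λ { (here refl) → InSpan-here vectors x ; (there y∈E) → InSpan-there x (spans y∈E) }
  }
  where open Basis B

embed∈odd-combinations : ∀ {m} {S : List (Point m)} {u} → InSpan S (embed u) →
                         embed u ∈ map (combination S) (elems parity)
embed∈odd-combinations {S = S} (a , eq) =
  subst (_∈ map (combination S) (elems parity)) eq
        (∈-map⁺ (combination S) (∈-elems⁺ {X = parity} (trans (sym (head-combination S a)) (cong head eq))))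

embedded-unique : ∀ {m} (Y : Subset m) → Unique (map embed (elems Y))
embedded-unique Y = Unique.map⁺ ∷-injectiveʳ (elems-unique Y)

embedded⊆odd-combinations : ∀ {m} {Y : Subset m} {S : List (Point m)} →
                            (∀ {y} → y ∈ elems Y → InSpan S (embed y)) →
                            map embed (elems Y) ⊆ map (combination S) (elems parity)
embedded⊆odd-combinations {S = S} spans v∈ with ∈-map⁻ embed v∈
... | y , y∈Y , refl = embed∈odd-combinations {S = S} (spans y∈Y)

spanned⇒∣∣≤∣parity∣ : ∀ {m} {Y : Subset m} {S : List (Point m)} →
              (∀ {y} → y ∈ elems Y → InSpan S (embed y)) → ∣ Y ∣ ≤ ∣ parity {length S} ∣
spanned⇒∣∣≤∣parity∣ {Y = Y} {S} spans =
  subst₂ _≤_ (length-map embed (elems Y)) (length-map (combination S) (elems parity))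
    (Unique-⊆⇒length≤ _≟ᵥ_ (embedded-unique Y) (embedded⊆odd-combinations {S = S} spans))

2^k≤∣parity∣⇒k< : ∀ {k} n → 2 ^ k ≤ ∣ parity {n} ∣ → suc k ≤ n
2^k≤∣parity∣⇒k< {k} zero    2^k≤0 = ⊥-elim (<⇒≱ (m^n>0 2 k) 2^k≤0)
2^k≤∣parity∣⇒k< {k} (suc n) 2^k≤  = s≤s (2^-cancel-≤ (subst (2 ^ k ≤_) (∣parity∣≡2^ {k = n} refl) 2^k≤))

∣∣≡2^k⇒k<length : ∀ {m k} {Y : Subset m} {S : List (Point m)} → ∣ Y ∣ ≡ 2 ^ k →
                  (∀ {y} → y ∈ elems Y → InSpan S (embed y)) → suc k ≤ length S
∣∣≡2^k⇒k<length {S = S} ∣Y∣≡ spans =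
  2^k≤∣parity∣⇒k< (length S) (subst (_≤ _) ∣Y∣≡ (spanned⇒∣∣≤∣parity∣ {S = S} spans))

∣∣≡2^k⇒k<rank : ∀ {m k} (X : Subset m) → ∣ X ∣ ≡ 2 ^ k → suc k ≤ rank X
∣∣≡2^k⇒k<rank X ∣X∣≡ = ≤-trans (∣∣≡2^k⇒k<length {S = vectors} ∣X∣≡ spans)
                               (length≤rank X vectors∈sublists isIndependent)
  where open Basis (greedyBasis (elems X))

-- span S has exactly 2^k affine points and contains the 2^k points of Y, so it has no others.
outside∉span : ∀ {m k} {Y : Subset m} {S : List (Point m)} → ∣ Y ∣ ≡ 2 ^ k → length S ≡ suc k →
               (∀ {y} → y ∈ elems Y → InSpan S (embed y)) →
               ∀ {u} → Y u ≡ false → ¬ InSpan S (embed u)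
outside∉span {k = k} {Y} {S} ∣Y∣≡ ∣S∣≡ spans {u} Yu u∈span
  with ∈-map⁻ embed (odd⊆embedded (embed∈odd-combinations {S = S} u∈span))
  where
  odd⊆embedded : map (combination S) (elems parity) ⊆ map embed (elems Y)
  odd⊆embedded = Unique-⊆-length≥⇒⊇ _≟ᵥ_ (embedded-unique Y) (embedded⊆odd-combinations {S = S} spans)
    (≤-reflexive (begin
      length (map (combination S) (elems parity)) ≡⟨ length-map (combination S) (elems parity) ⟩
      ∣ parity {length S} ∣                         ≡⟨ ∣parity∣≡2^ ∣S∣≡ ⟩
      2 ^ k                                         ≡⟨ sym ∣Y∣≡ ⟩
      ∣ Y ∣                                         ≡⟨ sym (length-map embed (elems Y)) ⟩
      length (map embed (elems Y))                  ∎))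
    where open ≡-Reasoning
... | y , y∈Y , embed-u≡embed-y with ∷-injectiveʳ embed-u≡embed-y
...   | refl with trans (sym Yu) (∈-elems⁻ y∈Y)
...     | ()

shifted-combination∈span : ∀ {m} {S T : List (Point m)} {t} → (∀ {u} → u ∈ T → InSpan S (embed u ⊕ t)) →
                           ∀ b → InSpan S (combination T b ⊕ scale (parity b) t)
shifted-combination∈span {S = S} {[]} _ [] = subst (InSpan S) (sym (⊕-identityˡ 0ᵥ)) (InSpan-0ᵥ S)
shifted-combination∈span {S = S} {u ∷ T} {t} shifts (c ∷ b) =
  subst (InSpan S) regroup
    (InSpan-⊕ (InSpan-scale c (shifts (here refl))) (shifted-combination∈span {S = S} {T} (shifts ∘ there) b))
  where
  open ≡-Reasoning
  regroup : scale c (embed u ⊕ t) ⊕ (combination T b ⊕ scale (parity b) t) ≡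
            combination (u ∷ T) (c ∷ b) ⊕ scale (parity (c ∷ b)) t
  regroup = begin
    scale c (embed u ⊕ t) ⊕ (combination T b ⊕ scale (parity b) t)
      ≡⟨ cong (_⊕ _) (scale-⊕ c (embed u) t) ⟩
    (scale c (embed u) ⊕ scale c t) ⊕ (combination T b ⊕ scale (parity b) t)
      ≡⟨ interchange _ _ _ _ ⟩
    (scale c (embed u) ⊕ combination T b) ⊕ (scale c t ⊕ scale (parity b) t)
      ≡⟨ cong (_ ⊕_) (sym (scale-xor c (parity b) t)) ⟩
    combination (u ∷ T) (c ∷ b) ⊕ scale (parity (c ∷ b)) t ∎

-- S spans a hyperplane W; as t ∉ W, every point of T lies in t + W, and b ↦ Σ_b T + t
-- embeds the odd masks b of T into the even combinations of S.
avoiding-span⇒length≤ : ∀ {m} {S T : List (Point (suc m))} → Independent S → length S ≡ suc m →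
                        (∀ {u} → u ∈ T → ¬ InSpan S (embed u)) → Independent T → length T ≤ suc m
avoiding-span⇒length≤ {T = []} _ _ _ _ = z≤n
avoiding-span⇒length≤ {m} {S} {t ∷ T′} S-indep ∣S∣≡ avoids T-indep =
  s≤s (2^-cancel-≤ (subst (_≤ 2 ^ m) (∣parity∣≡2^ {k = length T′} refl) ∣odd∣≤∣even∣))
  where
  shift : V (length (t ∷ T′)) → V (suc (suc m))
  shift b = combination (t ∷ T′) b ⊕ embed t

  points-shift-into-span : ∀ {u} → u ∈ t ∷ T′ → InSpan S (embed u ⊕ embed t)
  points-shift-into-span {u} u∈T
    with Independent⇒spanning {S = t ∷ S} (Independent-∷ {S = S} S-indep (avoids (here refl)))
                               (cong suc ∣S∣≡) (embed u)
  ... | (false ∷ a) , eq = ⊥-elim (avoids u∈T (a , trans (sym (⊕-identityˡ (combination S a))) eq))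
  ... | (true  ∷ a) , eq = a , trans (sym (xyx⁻¹≈y (embed t) (combination S a))) (cong (_⊕ embed t) eq)

  shifted-unique : Unique (map shift (elems parity))
  shifted-unique = Unique.map⁺ (λ eq → combination-injective {S = t ∷ T′} T-indep (∙-cancelʳ (embed t) _ _ eq))
                               (elems-unique parity)

  shifted⊆even : map shift (elems parity) ⊆ map (combination S) (elems (compl parity))
  shifted⊆even v∈ with ∈-map⁻ shift v∈
  ... | b , b∈odd , refl with shifted-combination∈span {S = S} {t ∷ T′} points-shift-into-span b
  ...   | a , eq = subst (_∈ map (combination S) (elems (compl parity))) eq′
                     (∈-map⁺ (combination S) (∈-elems⁺ {X = compl parity} (cong not a-even)))
    where
    open ≡-Reasoning
    b-odd : parity b ≡ true
    b-odd = ∈-elems⁻ {X = parity} b∈odd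
    eq′ : combination S a ≡ shift b
    eq′ = trans eq (cong (λ c → combination (t ∷ T′) b ⊕ scale c (embed t)) b-odd)
    a-even : parity a ≡ false
    a-even = begin
      parity a                                ≡⟨ sym (head-combination S a) ⟩
      head (combination S a)                  ≡⟨ cong head eq′ ⟩
      head (combination (t ∷ T′) b ⊕ embed t) ≡⟨ head-⊕ (combination (t ∷ T′) b) (embed t) ⟩
      head (combination (t ∷ T′) b) xor true  ≡⟨ cong (_xor true) (trans (head-combination (t ∷ T′) b) b-odd) ⟩
      false                                   ∎

  ∣odd∣≤∣even∣ : ∣ parity {length (t ∷ T′)} ∣ ≤ 2 ^ m
  ∣odd∣≤∣even∣ = begin
    ∣ parity {length (t ∷ T′)} ∣                        ≡⟨ sym (length-map shift (elems parity)) ⟩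
    length (map shift (elems parity))                   ≤⟨ Unique-⊆⇒length≤ _≟ᵥ_ shifted-unique shifted⊆even ⟩
    length (map (combination S) (elems (compl parity))) ≡⟨ length-map (combination S) (elems (compl parity)) ⟩
    ∣ compl (parity {length S}) ∣                       ≡⟨ ∣compl-parity∣≡2^ ∣S∣≡ ⟩
    2 ^ m                                               ∎
    where open ≤-Reasoning

rank-complement≤ : ∀ {m} (X Y : Subset (suc m)) → (∀ p → X p ≡ not (Y p)) →
                   ∣ Y ∣ ≡ 2 ^ m → rank Y ≤ suc m → rank X ≤ suc m
rank-complement≤ {m} X Y X≡notY ∣Y∣≡ rankY≤ = rank≤ X independent-in-X⇒length≤
  where
  open Basis (greedyBasis (elems Y))

  ∣basis∣≡ : length vectors ≡ suc m
  ∣basis∣≡ = ≤-antisym (≤-trans (length≤rank Y vectors∈sublists isIndependent) rankY≤)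
                       (∣∣≡2^k⇒k<length {S = vectors} ∣Y∣≡ spans)

  independent-in-X⇒length≤ : ∀ {T} → T ∈ sublists (elems X) → Independent T → length T ≤ suc m
  independent-in-X⇒length≤ {T} T∈ T-indep =
    avoiding-span⇒length≤ {S = vectors} {T} isIndependent ∣basis∣≡ avoids T-indep
    where
    avoids : ∀ {u} → u ∈ T → ¬ InSpan vectors (embed u)
    avoids {u} u∈T = outside∉span {S = vectors} ∣Y∣≡ ∣basis∣≡ spans
                       (not-injective (trans (sym (X≡notY u)) (∈-elems⁻ (∈sublists⇒⊆ (elems X) T∈ u∈T))))

≡-within-window : ∀ {k x y} → k ≤ x → x ≤ suc k → k ≤ y → y ≤ suc k →
                  (x ≤ k → y ≤ k) → (y ≤ k → x ≤ k) → x ≡ y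
≡-within-window {k} {x} {y} k≤x x≤1+k k≤y y≤1+k x≤k⇒y≤k y≤k⇒x≤k with x ≤? k | y ≤? k
... | yes x≤k | _       = trans (≤-antisym x≤k k≤x) (≤-antisym k≤y (x≤k⇒y≤k x≤k))
... | no  x≰k | yes y≤k = ⊥-elim (x≰k (y≤k⇒x≤k y≤k))
... | no  x≰k | no  y≰k = trans (≤-antisym x≤1+k (≰⇒> x≰k)) (≤-antisym (≰⇒> y≰k) y≤1+k)

double≢1 : ∀ a → a + a ≢ 1
double≢1 a = even≢odd a 0 ∘ trans (cong (a +_) (+-identityʳ a))

half-of-double : ∀ {a b} → a + a ≡ b + b → a ≡ b
half-of-double {a} {b} eq = trans (n≡⌊n+n/2⌋ a) (trans (cong ⌊_/2⌋ eq) (sym (n≡⌊n+n/2⌋ b)))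

lemma4p5 : (m : ℕ) (G : Subset m) → ∣ G ∣ ≡ ∣ compl G ∣ → rank G ≡ rank (compl G)
lemma4p5 zero    G ∣G∣≡∣R∣ = ⊥-elim (double≢1 ∣ G ∣ (trans (cong (∣ G ∣ +_) ∣G∣≡∣R∣) (∣X∣+∣complX∣≡2^m G)))
lemma4p5 (suc m) G ∣G∣≡∣R∣ =
  ≡-within-window (∣∣≡2^k⇒k<rank G ∣G∣≡) (rank≤1+m G) (∣∣≡2^k⇒k<rank (compl G) ∣R∣≡) (rank≤1+m (compl G))
                  (rank-complement≤ (compl G) G (λ _ → refl) ∣G∣≡)
                  (rank-complement≤ G (compl G) (λ p → sym (not-involutive (G p))) ∣R∣≡)
  where
  ∣G∣≡ : ∣ G ∣ ≡ 2 ^ m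
  ∣G∣≡ = half-of-double (begin
    ∣ G ∣ + ∣ G ∣       ≡⟨ cong (∣ G ∣ +_) ∣G∣≡∣R∣ ⟩
    ∣ G ∣ + ∣ compl G ∣ ≡⟨ ∣X∣+∣complX∣≡2^m G ⟩
    2 ^ suc m           ≡⟨ cong (2 ^ m +_) (+-identityʳ (2 ^ m)) ⟩
    2 ^ m + 2 ^ m       ∎)
    where open ≡-Reasoning
  ∣R∣≡ : ∣ compl G ∣ ≡ 2 ^ m
  ∣R∣≡ = trans (sym ∣G∣≡∣R∣) ∣G∣≡
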